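{- Let $p,q$ be real numbers such that the sequence $n_{\mathcal T}=\sum_{i=1}^{n}q^{n-i}p^{i-1}$ ($n\ge 1$) consists of positive integers, with associated $\mathcal T$-nomial coefficients $\binom{n}{k}_{\mathcal T}$. For integers $n\ge 1$ and $k\ge 0$, $$\binom{n+k-1}{k}_{\mathcal T}=\sum_{1\le b_1\le b_2\le\cdots\le b_k\le n}\lambda^n_{b_1}\lambda^n_{b_2}\cdots\lambda^n_{b_k},$$ where $\lambda^n_i=q^{i-1}p^{n-i}$ for $i=1,\dots,n$ (the empty product for $k=0$ equals $1$).
   Context: Let $p,q\in\mathbb R$. The sequence $\mathcal T=(n_{\mathcal T})_{n\ge1}$ is defined by $n_{\mathcal T}=[x^n]\,\frac{x}{(1-px)(1-qx)}=\sum_{i=1}^{n}q^{n-i}p^{i-1}$; it is assumed that every $n_{\mathcal T}$ is a positive integer. Put $n_{\mathcal T}!=n_{\mathcal T}(n-1)_{\mathcal T}\cdots 1_{\mathcal T}$, $0_{\mathcal T}!=1$, and for integers $0\le k\le n$ define $\binom{n}{k}_{\mathcal T}=\frac{n_{\mathcal T}!}{k_{\mathcal T}!\,(n-k)_{\mathcal T}!}$; set $\binom{n}{k}_{\mathcal T}=0$ for $k>n$. -}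

module Defs where

open import Level using (Level)
open import Data.Nat as ℕ using (ℕ; zero; suc; _∸_; _≤ᵇ_)
open import Data.Nat.DivMod using (_/_)
open import Data.Bool using (if_then_else_)
open import Data.List using (List; []; _∷_; map; concatMap; upTo; foldr)
open import Algebra.Bundles using (CommutativeRing)

-- Truncated natural division (d = 0 gives 0); under the standing
-- hypotheses the denominators below are always positive.
div : ℕ → ℕ → ℕ
div m zero    = 0
div m (suc d) = m / suc d

Tfact : (ℕ → ℕ) → ℕ → ℕ
Tfact N zero    = 1
Tfact N (suc n) = N (suc n) ℕ.* Tfact N n

Tbinom : (ℕ → ℕ) → ℕ → ℕ → ℕ
Tbinom N n k =
  if k ≤ᵇ n then div (Tfact N n) (Tfact N k ℕ.* Tfact N (n ∸ k)) else 0

range : ℕ → ℕ → List ℕ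
range lo hi = map (lo ℕ.+_) (upTo (suc hi ∸ lo))

incSeqs : ℕ → ℕ → ℕ → List (List ℕ)
incSeqs lo hi zero    = [] ∷ []
incSeqs lo hi (suc k) = concatMap (λ b → map (b ∷_) (incSeqs b hi k)) (range lo hi)

module Over {c ℓ : Level} (R : CommutativeRing c ℓ) where
  open CommutativeRing R

  pow : Carrier → ℕ → Carrier
  pow x zero    = 1#
  pow x (suc m) = x * pow x m

  ι : ℕ → Carrier
  ι zero    = 0#
  ι (suc m) = 1# + ι m

  sumR : List Carrier → Carrier
  sumR = foldr _+_ 0#

  prodR : List Carrier → Carrier
  prodR = foldr _*_ 1#

  Tseq : Carrier → Carrier → ℕ → Carrier
  Tseq p q n = sumR (map (λ i → pow q (n ∸ i) * pow p (i ∸ 1)) (range 1 n))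

  lam : Carrier → Carrier → ℕ → ℕ → Carrier
  lam p q n i = pow q (i ∸ 1) * pow p (n ∸ i)

  hsum : Carrier → Carrier → ℕ → ℕ → Carrier
  hsum p q n k = sumR (map (λ bs → prodR (map (lam p q n) bs)) (incSeqs 1 n k))

-- Write T n for n_T and T! for the T-factorial, both computed in R.  Expanding the sum
-- over b₁ ≤ ⋯ ≤ b_k by its first letter, and using the addition formula
-- T (m + n) = p^m T n + q^n T m, shows T! k · T! (n-1) · (sum) = T! (n-1+k) in R.
-- To identify the sum with the truncated division in ℕ one also needs it to be an
-- integer of R: it equals the solution of a recurrence with integral coefficients
-- coming from T (m+1) T (n+1) = T (m+n+1) + pq T m T n, where pq = T 2² − T 3.
-- Characteristic zero and the absence of zero divisors then let ℕ-equalities and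
-- quotients be read off from R.

module Submission where

open import Defs
open import Level using (Level)
open import Data.Bool using (true)
open import Data.Nat as ℕ using (ℕ; zero; suc; _∸_; _≤_; _<_; NonZero)
import Data.Nat.Properties as ℕ
open import Data.Nat.DivMod using (_/_; m*n/n≡m)
open import Data.List using (List; []; _∷_; _++_; map; concatMap; upTo; applyUpTo)
import Data.List.Properties as List
open import Data.Product using (∃₂; _,_)
open import Data.Sum using (_⊎_; inj₁; inj₂)
open import Function using (_∘_)
open import Relation.Nullary using (¬_)
open import Relation.Binary.PropositionalEquality as ≡ using (_≡_; cong)
open import Algebra.Bundles using (CommutativeRing)

range-cons : ∀ {lo hi} → lo ≤ hi → range lo hi ≡ lo ∷ range (suc lo) hi
range-cons {lo} {hi} lo≤hi = begin
  map (lo ℕ.+_) (upTo (suc hi ∸ lo))       ≡⟨ cong (map (lo ℕ.+_) ∘ upTo) (ℕ.+-∸-assoc 1 lo≤hi) ⟩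
  map (lo ℕ.+_) (upTo (suc (hi ∸ lo)))     ≡⟨ ≡.cong₂ _∷_ (ℕ.+-identityʳ lo) shift ⟩
  lo ∷ map (suc lo ℕ.+_) (upTo (hi ∸ lo))  ∎
  where
  open ≡.≡-Reasoning
  shift : map (lo ℕ.+_) (applyUpTo suc (hi ∸ lo)) ≡ map (suc lo ℕ.+_) (upTo (hi ∸ lo))
  shift = begin
    map (lo ℕ.+_) (applyUpTo suc (hi ∸ lo))   ≡⟨ cong (map (lo ℕ.+_)) (≡.sym (List.map-upTo suc _)) ⟩
    map (lo ℕ.+_) (map suc (upTo (hi ∸ lo)))  ≡⟨ List.map-∘ _ ⟨
    map ((lo ℕ.+_) ∘ suc) (upTo (hi ∸ lo))    ≡⟨ List.map-cong (ℕ.+-suc lo) _ ⟩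
    map (suc lo ℕ.+_) (upTo (hi ∸ lo))        ∎

range-empty : ∀ {lo hi} → hi < lo → range lo hi ≡ []
range-empty {lo} hi<lo = cong (map (lo ℕ.+_) ∘ upTo) (ℕ.m≤n⇒m∸n≡0 hi<lo)

m+n*u≡n*v⇒m≡n*[v∸u] : ∀ m n u v → m ℕ.+ n ℕ.* u ≡ n ℕ.* v → m ≡ n ℕ.* (v ∸ u)
m+n*u≡n*v⇒m≡n*[v∸u] m n u v eq = begin
  m                        ≡⟨ ℕ.m+n∸n≡m m (n ℕ.* u) ⟨
  m ℕ.+ n ℕ.* u ∸ n ℕ.* u  ≡⟨ cong (_∸ n ℕ.* u) eq ⟩
  n ℕ.* v ∸ n ℕ.* u        ≡⟨ ℕ.*-distribˡ-∸ n v u ⟨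
  n ℕ.* (v ∸ u)            ∎
  where open ≡.≡-Reasoning

div-*ˡ : ∀ m n .{{_ : NonZero m}} → div (m ℕ.* n) m ≡ n
div-*ˡ (suc m) n = ≡.trans (cong (_/ suc m) (ℕ.*-comm (suc m) n)) (m*n/n≡m n (suc m))

Tbinom-≤ : ∀ N {n k} → k ≤ n → Tbinom N n k ≡ div (Tfact N n) (Tfact N k ℕ.* Tfact N (n ∸ k))
Tbinom-≤ N {n} {k} k≤n with k ℕ.≤ᵇ n | ℕ.≤⇒≤ᵇ k≤n
... | true | _ = ≡.refl

Tfact-nonZero : ∀ N → (∀ n → 1 ≤ n → 0 < N n) → ∀ j → NonZero (Tfact N j)
Tfact-nonZero N pos zero    = _
Tfact-nonZero N pos (suc j) =
  ℕ.m*n≢0 (N (suc j)) (Tfact N j) {{ℕ.>-nonZero (pos (suc j) (ℕ.s≤s ℕ.z≤n))}} {{Tfact-nonZero N pos j}}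

module RingTheory {c ℓ : Level} (R : CommutativeRing c ℓ) where
  open CommutativeRing R
  open Over R
  open import Algebra.Definitions _≈_ using (AlmostLeftCancellative)
  open import Algebra.Properties.Ring ring using (+-cancelˡ; x∙y⁻¹≈ε⇒x≈y; x[y-z]≈xy-xz; //-rightDividesˡ)
  open import Algebra.Properties.Semiring.Mult semiring using (_×_; ×-homo-+; ×1-homo-*)
  open import Algebra.Properties.CommutativeSemiring.Exp commutativeSemiring using (_^_)
  open import Algebra.Solver.Ring.NaturalCoefficients.Default commutativeSemiring
  open import Relation.Binary.Reasoning.Setoid setoid

  pow≈^ : ∀ x n → pow x n ≈ x ^ n
  pow≈^ x zero    = refl
  pow≈^ x (suc n) = *-congˡ (pow≈^ x n)

  ι≈×1# : ∀ n → ι n ≈ n × 1#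
  ι≈×1# zero    = refl
  ι≈×1# (suc n) = +-congˡ (ι≈×1# n)

  ι-homo-+ : ∀ m n → ι (m ℕ.+ n) ≈ ι m + ι n
  ι-homo-+ m n = begin
    ι (m ℕ.+ n)        ≈⟨ ι≈×1# (m ℕ.+ n) ⟩
    (m ℕ.+ n) × 1#     ≈⟨ ×-homo-+ 1# m n ⟩
    m × 1# + n × 1#    ≈⟨ +-cong (ι≈×1# m) (ι≈×1# n) ⟨
    ι m + ι n          ∎

  ι-homo-* : ∀ m n → ι (m ℕ.* n) ≈ ι m * ι n
  ι-homo-* m n = begin
    ι (m ℕ.* n)         ≈⟨ ι≈×1# (m ℕ.* n) ⟩
    (m ℕ.* n) × 1#      ≈⟨ ×1-homo-* m n ⟩
    m × 1# * (n × 1#)   ≈⟨ *-cong (ι≈×1# m) (ι≈×1# n) ⟨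
    ι m * ι n           ∎

  HasCharZero : Set ℓ
  HasCharZero = ∀ m → ¬ ι (suc m) ≈ 0#

  NoZeroDivisors : Set (c Level.⊔ ℓ)
  NoZeroDivisors = ∀ x y → x * y ≈ 0# → x ≈ 0# ⊎ y ≈ 0#

  ι-injective : HasCharZero → ∀ m n → ι m ≈ ι n → m ≡ n
  ι-injective char0 zero    zero    _  = ≡.refl
  ι-injective char0 zero    (suc n) eq with () ← char0 n (sym eq)
  ι-injective char0 (suc m) zero    eq with () ← char0 m eq
  ι-injective char0 (suc m) (suc n) eq = cong suc (ι-injective char0 m n (+-cancelˡ 1# (ι m) (ι n) eq))

  ι-nonZero : HasCharZero → ∀ n .{{_ : NonZero n}} → ¬ ι n ≈ 0#
  ι-nonZero char0 (suc n) = char0 n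

  *-almostCancelˡ : NoZeroDivisors → AlmostLeftCancellative 0# _*_
  *-almostCancelˡ noZeroDiv x y z x≉0 xy≈xz
    with noZeroDiv x (y - z) (trans (x[y-z]≈xy-xz x y z) (trans (+-congʳ xy≈xz) (-‿inverseʳ (x * z))))
  ... | inj₁ x≈0   with () ← x≉0 x≈0
  ... | inj₂ y-z≈0 = x∙y⁻¹≈ε⇒x≈y y z y-z≈0

  -- x is the image of an integer, given as a difference v - u of naturals.
  Integral : Carrier → Set ℓ
  Integral x = ∃₂ λ u v → x + ι u ≈ ι v

  Integral-resp-≈ : ∀ {x y} → x ≈ y → Integral x → Integral y
  Integral-resp-≈ x≈y (u , v , eq) = u , v , trans (+-congʳ (sym x≈y)) eq

  ι-integral : ∀ n → Integral (ι n)
  ι-integral n = 0 , n , +-identityʳ (ι n)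

  1#-integral : Integral 1#
  1#-integral = 0 , 1 , refl

  Integral-- : ∀ {x y} → Integral x → Integral y → Integral (x - y)
  Integral-- {x} {y} (u , v , x+u≈v) (u′ , v′ , y+u′≈v′) = u ℕ.+ v′ , v ℕ.+ u′ , (begin
    x - y + ι (u ℕ.+ v′)         ≈⟨ +-congˡ (trans (ι-homo-+ u v′) (+-congˡ (sym y+u′≈v′))) ⟩
    x - y + (ι u + (y + ι u′))   ≈⟨ solve 4 (λ d a b e → d :+ (a :+ (b :+ e)) := d :+ b :+ a :+ e) refl (x - y) (ι u) y (ι u′) ⟩
    x - y + y + ι u + ι u′       ≈⟨ +-congʳ (+-congʳ (//-rightDividesˡ y x)) ⟩
    x + ι u + ι u′               ≈⟨ +-congʳ x+u≈v ⟩
    ι v + ι u′                   ≈⟨ ι-homo-+ v u′ ⟨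
    ι (v ℕ.+ u′)                 ∎)

  Integral-* : ∀ {x y} → Integral x → Integral y → Integral (x * y)
  Integral-* {x} {y} (u , v , x+u≈v) (u′ , v′ , y+u′≈v′) =
    u ℕ.* v′ ℕ.+ v ℕ.* u′ , v ℕ.* v′ ℕ.+ u ℕ.* u′ , (begin
      x * y + ι (u ℕ.* v′ ℕ.+ v ℕ.* u′)
        ≈⟨ +-congˡ (ι-+-* u v′ v u′) ⟩
      x * y + (ι u * ι v′ + ι v * ι u′)
        ≈⟨ +-congˡ (+-cong (*-congˡ (sym y+u′≈v′)) (*-congʳ (sym x+u≈v))) ⟩
      x * y + (ι u * (y + ι u′) + (x + ι u) * ι u′)
        ≈⟨ solve 4 (λ a b c d → a :* b :+ (c :* (b :+ d) :+ (a :+ c) :* d) := (a :+ c) :* (b :+ d) :+ c :* d)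
                   refl x y (ι u) (ι u′) ⟩
      (x + ι u) * (y + ι u′) + ι u * ι u′
        ≈⟨ +-congʳ (*-cong x+u≈v y+u′≈v′) ⟩
      ι v * ι v′ + ι u * ι u′
        ≈⟨ ι-+-* v v′ u u′ ⟨
      ι (v ℕ.* v′ ℕ.+ u ℕ.* u′) ∎)
    where
    ι-+-* : ∀ a b c d → ι (a ℕ.* b ℕ.+ c ℕ.* d) ≈ ι a * ι b + ι c * ι d
    ι-+-* a b c d = trans (ι-homo-+ (a ℕ.* b) (c ℕ.* d)) (+-cong (ι-homo-* a b) (ι-homo-* c d))

  ι-div : NoZeroDivisors → HasCharZero →
          ∀ {x} a b .{{_ : NonZero b}} → Integral x → ι b * x ≈ ι a → ι (div a b) ≈ x
  ι-div noZeroDiv char0 {x} a b (u , v , x+u≈v) bx≈a =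
    *-almostCancelˡ noZeroDiv (ι b) _ x (ι-nonZero char0 b) (begin
      ι b * ι (div a b)                ≡⟨ cong (λ m → ι b * ι (div m b)) a≡b[v∸u] ⟩
      ι b * ι (div (b ℕ.* (v ∸ u)) b)  ≡⟨ cong (λ m → ι b * ι m) (div-*ˡ b (v ∸ u)) ⟩
      ι b * ι (v ∸ u)                  ≈⟨ ι-homo-* b (v ∸ u) ⟨
      ι (b ℕ.* (v ∸ u))                ≡⟨ cong ι a≡b[v∸u] ⟨
      ι a                              ≈⟨ bx≈a ⟨
      ι b * x                          ∎)
    where
    a+bu≡bv : a ℕ.+ b ℕ.* u ≡ b ℕ.* v
    a+bu≡bv = ι-injective char0 _ _ (begin
      ι (a ℕ.+ b ℕ.* u)      ≈⟨ trans (ι-homo-+ a (b ℕ.* u)) (+-cong (sym bx≈a) (ι-homo-* b u)) ⟩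
      ι b * x + ι b * ι u    ≈⟨ distribˡ (ι b) x (ι u) ⟨
      ι b * (x + ι u)        ≈⟨ *-congˡ x+u≈v ⟩
      ι b * ι v              ≈⟨ ι-homo-* b v ⟨
      ι (b ℕ.* v)            ∎)
    a≡b[v∸u] : a ≡ b ℕ.* (v ∸ u)
    a≡b[v∸u] = m+n*u≡n*v⇒m≡n*[v∸u] a b u v a+bu≡bv

  sumR-++ : ∀ xs ys → sumR (xs ++ ys) ≈ sumR xs + sumR ys
  sumR-++ []       ys = sym (+-identityˡ (sumR ys))
  sumR-++ (x ∷ xs) ys = trans (+-congˡ (sumR-++ xs ys)) (sym (+-assoc x (sumR xs) (sumR ys)))

  sumR-map-cong : ∀ {A : Set} {f g : A → Carrier} → (∀ a → f a ≈ g a) →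
                  ∀ xs → sumR (map f xs) ≈ sumR (map g xs)
  sumR-map-cong f≈g []       = refl
  sumR-map-cong f≈g (x ∷ xs) = +-cong (f≈g x) (sumR-map-cong f≈g xs)

  sumR-map-*ˡ : ∀ {A : Set} a (f : A → Carrier) xs →
                sumR (map (λ x → a * f x) xs) ≈ a * sumR (map f xs)
  sumR-map-*ˡ a f []       = sym (zeroʳ a)
  sumR-map-*ˡ a f (x ∷ xs) = trans (+-congˡ (sumR-map-*ˡ a f xs)) (sym (distribˡ a (f x) _))

  sumR-map-concatMap : ∀ {A B : Set} (f : B → Carrier) (g : A → List B) xs →
    sumR (map f (concatMap g xs)) ≈ sumR (map (λ x → sumR (map f (g x))) xs)
  sumR-map-concatMap f g []       = refl
  sumR-map-concatMap f g (x ∷ xs) = begin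
    sumR (map f (g x ++ concatMap g xs))                 ≡⟨ cong sumR (List.map-++ f (g x) _) ⟩
    sumR (map f (g x) ++ map f (concatMap g xs))         ≈⟨ sumR-++ (map f (g x)) _ ⟩
    sumR (map f (g x)) + sumR (map f (concatMap g xs))   ≈⟨ +-congˡ (sumR-map-concatMap f g xs) ⟩
    sumR (map f (g x)) + sumR (map (λ y → sumR (map f (g y))) xs) ∎

  h : (ℕ → Carrier) → ℕ → ℕ → ℕ → Carrier
  h w lo hi k = sumR (map (prodR ∘ map w) (incSeqs lo hi k))

  h-suc : ∀ w lo hi k → h w lo hi (suc k) ≈ sumR (map (λ b → w b * h w b hi k) (range lo hi))
  h-suc w lo hi k = trans (sumR-map-concatMap _ (λ b → map (b ∷_) (incSeqs b hi k)) (range lo hi))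
                          (sumR-map-cong first-letter (range lo hi))
    where
    first-letter : ∀ b → sumR (map (prodR ∘ map w) (map (b ∷_) (incSeqs b hi k))) ≈ w b * h w b hi k
    first-letter b = trans (reflexive (cong sumR (≡.sym (List.map-∘ (incSeqs b hi k)))))
                           (sumR-map-*ˡ (w b) (prodR ∘ map w) (incSeqs b hi k))

  h-suc-≤ : ∀ w {lo hi} k → lo ≤ hi → h w lo hi (suc k) ≈ w lo * h w lo hi k + h w (suc lo) hi (suc k)
  h-suc-≤ w {lo} {hi} k lo≤hi = begin
    h w lo hi (suc k)                                           ≈⟨ h-suc w lo hi k ⟩
    sumR (map (λ b → w b * h w b hi k) (range lo hi))           ≡⟨ cong (sumR ∘ map _) (range-cons lo≤hi) ⟩
    w lo * h w lo hi k + sumR (map (λ b → w b * h w b hi k) (range (suc lo) hi))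
                                                                ≈⟨ +-congˡ (h-suc w (suc lo) hi k) ⟨
    w lo * h w lo hi k + h w (suc lo) hi (suc k)                ∎

  h-suc-> : ∀ w {lo hi} k → hi < lo → h w lo hi (suc k) ≈ 0#
  h-suc-> w {lo} {hi} k hi<lo = trans (h-suc w lo hi k) (reflexive (cong (sumR ∘ map _) (range-empty hi<lo)))

module TSequence {c ℓ : Level} (R : CommutativeRing c ℓ) (p q : CommutativeRing.Carrier R) where
  open CommutativeRing R
  open Over R
  open RingTheory R
  open import Algebra.Properties.Ring ring using (x[y-z]≈xy-xz; //-rightDividesʳ)
  open import Algebra.Properties.CommutativeSemiring.Exp commutativeSemiring using (_^_; ^-homo-*; ^-distrib-*; ^-assocʳ)
  open import Algebra.Solver.Ring.NaturalCoefficients.Default commutativeSemiring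
  open import Relation.Binary.Reasoning.Setoid setoid

  T : ℕ → Carrier
  T = Tseq p q

  T! : ℕ → Carrier
  T! zero    = 1#
  T! (suc n) = T (suc n) * T! n

  T≡sum-upTo : ∀ n → T n ≡ sumR (map (λ j → pow q (n ∸ suc j) * pow p j) (upTo n))
  T≡sum-upTo n = cong sumR (≡.sym (List.map-∘ (upTo n)))

  T-1 : T 1 ≈ 1#
  T-1 = trans (+-identityʳ (1# * 1#)) (*-identityˡ 1#)

  T-suc-q : ∀ n → T (suc n) ≈ q ^ n + p * T n
  T-suc-q n = begin
    T (suc n)                                                   ≡⟨ T≡sum-upTo (suc n) ⟩
    G 0 + sumR (map G (applyUpTo suc n))                        ≡⟨ cong (λ xs → G 0 + sumR xs) shift ⟩
    G 0 + sumR (map (G ∘ suc) (upTo n))                         ≈⟨ +-cong (trans (*-identityʳ _) (pow≈^ q n))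
                                                                          (sumR-map-cong pull-p (upTo n)) ⟩
    q ^ n + sumR (map (λ j → p * (pow q (n ∸ suc j) * pow p j)) (upTo n))
                                                                ≈⟨ +-congˡ (sumR-map-*ˡ p _ (upTo n)) ⟩
    q ^ n + p * sumR (map (λ j → pow q (n ∸ suc j) * pow p j) (upTo n))
                                                                ≡⟨ cong (λ x → q ^ n + p * x) (T≡sum-upTo n) ⟨
    q ^ n + p * T n                                             ∎
    where
    G : ℕ → Carrier
    G j = pow q (suc n ∸ suc j) * pow p j
    shift : map G (applyUpTo suc n) ≡ map (G ∘ suc) (upTo n)
    shift = ≡.trans (List.map-applyUpTo suc G n) (≡.sym (List.map-upTo (G ∘ suc) n))
    pull-p : ∀ j → G (suc j) ≈ p * (pow q (n ∸ suc j) * pow p j)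
    pull-p j = solve 3 (λ x y z → x :* (y :* z) := y :* (x :* z)) refl (pow q (n ∸ suc j)) p (pow p j)

  T-+ : ∀ m n → T (m ℕ.+ n) ≈ p ^ m * T n + q ^ n * T m
  T-+ zero    n = solve 2 (λ x y → x := con 1 :* x :+ y :* con 0) refl (T n) (q ^ n)
  T-+ (suc m) n = begin
    T (suc (m ℕ.+ n))                                  ≈⟨ T-suc-q (m ℕ.+ n) ⟩
    q ^ (m ℕ.+ n) + p * T (m ℕ.+ n)                    ≈⟨ +-cong (^-homo-* q m n) (*-congˡ (T-+ m n)) ⟩
    q ^ m * q ^ n + p * (p ^ m * T n + q ^ n * T m)
      ≈⟨ solve 6 (λ qm qn P pm tn tm → qm :* qn :+ P :* (pm :* tn :+ qn :* tm) := P :* pm :* tn :+ qn :* (qm :+ P :* tm))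
                 refl (q ^ m) (q ^ n) p (p ^ m) (T n) (T m) ⟩
    p * p ^ m * T n + q ^ n * (q ^ m + p * T m)        ≈⟨ +-congˡ (*-congˡ (T-suc-q m)) ⟨
    p ^ suc m * T n + q ^ n * T (suc m)                ∎

  T-suc-p : ∀ n → T (suc n) ≈ p ^ n + q * T n
  T-suc-p n = begin
    T (suc n)                  ≡⟨ cong T (ℕ.+-comm 1 n) ⟩
    T (n ℕ.+ 1)                ≈⟨ T-+ n 1 ⟩
    p ^ n * T 1 + q ^ 1 * T n  ≈⟨ +-cong (trans (*-congˡ T-1) (*-identityʳ _)) (*-congʳ (*-identityʳ q)) ⟩
    p ^ n + q * T n            ∎

  T-suc-*-suc : ∀ m n → T (suc m) * T (suc n) ≈ T (suc m ℕ.+ n) + p * q * T m * T n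
  T-suc-*-suc m n = begin
    T (suc m) * T (suc n)                                ≈⟨ *-congˡ (T-suc-q n) ⟩
    T (suc m) * (q ^ n + p * T n)
      ≈⟨ solve 4 (λ a qn P tn → a :* (qn :+ P :* tn) := qn :* a :+ P :* tn :* a) refl (T (suc m)) (q ^ n) p (T n) ⟩
    q ^ n * T (suc m) + p * T n * T (suc m)              ≈⟨ +-congˡ (*-congˡ (T-suc-p m)) ⟩
    q ^ n * T (suc m) + p * T n * (p ^ m + q * T m)
      ≈⟨ solve 7 (λ qn a P Q tn pm tm → qn :* a :+ P :* tn :* (pm :+ Q :* tm) := P :* pm :* tn :+ qn :* a :+ P :* Q :* tm :* tn)
                 refl (q ^ n) (T (suc m)) p q (T n) (p ^ m) (T m) ⟩
    p ^ suc m * T n + q ^ n * T (suc m) + p * q * T m * T n  ≈⟨ +-congʳ (T-+ (suc m) n) ⟨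
    T (suc m ℕ.+ n) + p * q * T m * T n                  ∎

  -- binom(m + k, k)_T computed in R by a recurrence with integral coefficients.
  Tnom : ℕ → ℕ → Carrier
  Tnom zero    k       = 1#
  Tnom (suc m) zero    = 1#
  Tnom (suc m) (suc k) = T (suc (suc m)) * Tnom (suc m) k - p * q * T k * Tnom m (suc k)

  T!-Tnom : ∀ m k → T! k * T! m * Tnom m k ≈ T! (m ℕ.+ k)
  T!-Tnom zero    k    = solve 1 (λ x → x :* con 1 :* con 1 := x) refl (T! k)
  T!-Tnom (suc m) zero = trans (solve 1 (λ x → con 1 :* x :* con 1 := x) refl (T! (suc m)))
                               (reflexive (cong T! (≡.sym (ℕ.+-identityʳ (suc m)))))
  T!-Tnom (suc m) (suc k) = begin
    X * (a - b)                         ≈⟨ x[y-z]≈xy-xz X a b ⟩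
    X * a - X * b                       ≈⟨ +-congʳ Xa≈ ⟩
    T! (suc (suc m ℕ.+ k)) + X * b - X * b  ≈⟨ //-rightDividesʳ (X * b) _ ⟩
    T! (suc (suc m ℕ.+ k))              ≡⟨ cong (T! ∘ suc) (ℕ.+-suc m k) ⟨
    T! (suc m ℕ.+ suc k)                ∎
    where
    X a b G : Carrier
    X = T! (suc k) * T! (suc m)
    a = T (suc (suc m)) * Tnom (suc m) k
    b = p * q * T k * Tnom m (suc k)
    G = T! (suc m ℕ.+ k)
    Xb≈ : X * b ≈ p * q * T (suc m) * T k * G
    Xb≈ = begin
      X * b
        ≈⟨ solve 7 (λ f tm fm P Q tk c → f :* (tm :* fm) :* (P :* Q :* tk :* c) := P :* Q :* tm :* tk :* (f :* fm :* c))
                   refl (T! (suc k)) (T (suc m)) (T! m) p q (T k) (Tnom m (suc k)) ⟩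
      p * q * T (suc m) * T k * (T! (suc k) * T! m * Tnom m (suc k))
        ≈⟨ *-congˡ (trans (T!-Tnom m (suc k)) (reflexive (cong T! (ℕ.+-suc m k)))) ⟩
      p * q * T (suc m) * T k * G ∎
    Xa≈ : X * a ≈ T! (suc (suc m ℕ.+ k)) + X * b
    Xa≈ = begin
      X * a
        ≈⟨ solve 5 (λ tk fk f t2 c → tk :* fk :* f :* (t2 :* c) := t2 :* tk :* (fk :* f :* c))
                   refl (T (suc k)) (T! k) (T! (suc m)) (T (suc (suc m))) (Tnom (suc m) k) ⟩
      T (suc (suc m)) * T (suc k) * (T! k * T! (suc m) * Tnom (suc m) k)
        ≈⟨ *-congˡ (T!-Tnom (suc m) k) ⟩
      T (suc (suc m)) * T (suc k) * G
        ≈⟨ *-congʳ (T-suc-*-suc (suc m) k) ⟩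
      (T (suc (suc m) ℕ.+ k) + p * q * T (suc m) * T k) * G
        ≈⟨ distribʳ G _ _ ⟩
      T! (suc (suc m ℕ.+ k)) + p * q * T (suc m) * T k * G
        ≈⟨ +-congˡ Xb≈ ⟨
      T! (suc (suc m ℕ.+ k)) + X * b ∎

  lam≈ : ∀ n i → lam p q n (suc i) ≈ q ^ i * p ^ (n ∸ suc i)
  lam≈ n i = *-cong (pow≈^ q i) (pow≈^ p (n ∸ suc i))

  -- Summing from suc l instead of 1 rescales every weight by q ^ l.
  T!-h-lam : ∀ {n} l m k → suc l ℕ.+ m ≡ n →
             T! k * T! m * h (lam p q n) (suc l) n k ≈ (q ^ l) ^ k * T! (m ℕ.+ k)
  T!-h-lam l m zero _ =
    trans (solve 1 (λ x → con 1 :* x :* (con 1 :+ con 0) := con 1 :* x) refl (T! m))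
          (reflexive (cong (λ j → 1# * T! j) (≡.sym (ℕ.+-identityʳ m))))
  T!-h-lam l zero (suc k) ≡.refl rewrite ℕ.+-identityʳ l = begin
    T! (suc k) * 1# * hₗ (suc k)
      ≈⟨ *-congˡ (h-suc-≤ w k ℕ.≤-refl) ⟩
    T! (suc k) * 1# * (w (suc l) * hₗ k + h w (suc (suc l)) (suc l) (suc k))
      ≈⟨ *-congˡ (+-cong (*-congʳ w≈) (h-suc-> w {hi = suc l} k ℕ.≤-refl)) ⟩
    T! (suc k) * 1# * (q ^ l * hₗ k + 0#)
      ≈⟨ solve 4 (λ t f c x → t :* f :* con 1 :* (c :* x :+ con 0) := t :* c :* (f :* con 1 :* x))
                 refl (T (suc k)) (T! k) (q ^ l) (hₗ k) ⟩
    T (suc k) * q ^ l * (T! k * 1# * hₗ k)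
      ≈⟨ *-congˡ (T!-h-lam l 0 k (ℕ.+-identityʳ (suc l))) ⟩
    T (suc k) * q ^ l * ((q ^ l) ^ k * T! k)
      ≈⟨ solve 4 (λ t c ck f → t :* c :* (ck :* f) := c :* ck :* (t :* f)) refl (T (suc k)) (q ^ l) ((q ^ l) ^ k) (T! k) ⟩
    (q ^ l) ^ suc k * T! (suc k) ∎
    where
    w : ℕ → Carrier
    w = lam p q (suc l)
    hₗ : ℕ → Carrier
    hₗ = h w (suc l) (suc l)
    w≈ : w (suc l) ≈ q ^ l
    w≈ = trans (lam≈ (suc l) l) (trans (*-congˡ (reflexive (cong (p ^_) (ℕ.n∸n≡0 l)))) (*-identityʳ (q ^ l)))
  T!-h-lam {n} l (suc m) (suc k) e = begin
    T! (suc k) * T! (suc m) * hₙ (suc l) (suc k)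
      ≈⟨ *-congˡ (h-suc-≤ w k (≡.subst (suc l ≤_) e (ℕ.m≤m+n (suc l) (suc m)))) ⟩
    T! (suc k) * T! (suc m) * (w (suc l) * hₙ (suc l) k + hₙ (suc (suc l)) (suc k))
      ≈⟨ *-congˡ (+-congʳ (*-congʳ w≈)) ⟩
    T! (suc k) * T! (suc m) * (q ^ l * p ^ suc m * hₙ (suc l) k + hₙ (suc (suc l)) (suc k))
      ≈⟨ solve 8 (λ tk fk tm fm c P x y → tk :* fk :* (tm :* fm) :* (c :* P :* x :+ y)
                                       := tk :* c :* P :* (fk :* (tm :* fm) :* x) :+ tm :* (tk :* fk :* fm :* y))
                 refl (T (suc k)) (T! k) (T (suc m)) (T! m) (q ^ l) (p ^ suc m) (hₙ (suc l) k) (hₙ (suc (suc l)) (suc k)) ⟩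
    T (suc k) * q ^ l * p ^ suc m * (T! k * T! (suc m) * hₙ (suc l) k)
      + T (suc m) * (T! (suc k) * T! m * hₙ (suc (suc l)) (suc k))
      ≈⟨ +-cong (*-congˡ (T!-h-lam l (suc m) k e)) (*-congˡ (T!-h-lam (suc l) m (suc k) e′)) ⟩
    T (suc k) * q ^ l * p ^ suc m * ((q ^ l) ^ k * G) + T (suc m) * ((q * q ^ l) ^ suc k * T! (m ℕ.+ suc k))
      ≈⟨ +-congˡ (*-congˡ (*-cong (^-distrib-* q (q ^ l) (suc k)) (reflexive (cong T! (ℕ.+-suc m k))))) ⟩
    T (suc k) * q ^ l * p ^ suc m * ((q ^ l) ^ k * G) + T (suc m) * (q ^ suc k * (q ^ l) ^ suc k * G)
      ≈⟨ solve 7 (λ tk c P ck g tm Q → tk :* c :* P :* (ck :* g) :+ tm :* (Q :* (c :* ck) :* g)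
                                     := c :* ck :* ((P :* tk :+ Q :* tm) :* g))
                 refl (T (suc k)) (q ^ l) (p ^ suc m) ((q ^ l) ^ k) G (T (suc m)) (q ^ suc k) ⟩
    (q ^ l) ^ suc k * ((p ^ suc m * T (suc k) + q ^ suc k * T (suc m)) * G)
      ≈⟨ *-congˡ (*-congʳ (trans (reflexive (cong (T ∘ suc) (≡.sym (ℕ.+-suc m k)))) (T-+ (suc m) (suc k)))) ⟨
    (q ^ l) ^ suc k * T! (suc (suc m ℕ.+ k))
      ≡⟨ cong (λ j → (q ^ l) ^ suc k * T! (suc j)) (ℕ.+-suc m k) ⟨
    (q ^ l) ^ suc k * T! (suc m ℕ.+ suc k) ∎
    where
    w : ℕ → Carrier
    w = lam p q n
    hₙ : ℕ → ℕ → Carrier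
    hₙ lo = h w lo n
    G : Carrier
    G = T! (suc m ℕ.+ k)
    e′ : suc (suc l) ℕ.+ m ≡ n
    e′ = ≡.trans (cong suc (≡.sym (ℕ.+-suc l m))) e
    w≈ : w (suc l) ≈ q ^ l * p ^ suc m
    w≈ = trans (lam≈ n l) (*-congˡ (reflexive (cong (p ^_) (≡.trans (cong (_∸ suc l) (≡.sym e)) (ℕ.m+n∸m≡n (suc l) (suc m))))))

  T!-hsum : ∀ m k → T! k * T! m * hsum p q (suc m) k ≈ T! (m ℕ.+ k)
  T!-hsum m k = trans (T!-h-lam 0 m k ≡.refl) (trans (*-congʳ (^-assocʳ q 0 k)) (*-identityˡ (T! (m ℕ.+ k))))

module TIntegrality {c ℓ : Level} (R : CommutativeRing c ℓ) (p q : CommutativeRing.Carrier R)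
                    (N : ℕ → ℕ) (N-positive : ∀ n → 1 ≤ n → 0 < N n)
                    (ι-N≈T : ∀ n → 1 ≤ n → CommutativeRing._≈_ R (Over.ι R (N n)) (Over.Tseq R p q n)) where
  open CommutativeRing R
  open Over R
  open RingTheory R
  open TSequence R p q
  open import Algebra.Properties.Ring ring using (//-rightDividesʳ)
  open import Relation.Binary.Reasoning.Setoid setoid

  T-integral : ∀ n → Integral (T n)
  T-integral zero    = ι-integral 0
  T-integral (suc n) = Integral-resp-≈ (ι-N≈T (suc n) (ℕ.s≤s ℕ.z≤n)) (ι-integral (N (suc n)))

  pq-integral : Integral (p * q)
  pq-integral = Integral-resp-≈ T₂²-T₃≈pq (Integral-- (Integral-* (T-integral 2) (T-integral 2)) (T-integral 3))
    where
    T₂²-T₃≈pq : T 2 * T 2 - T 3 ≈ p * q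
    T₂²-T₃≈pq = begin
      T 2 * T 2 - T 3                   ≈⟨ +-congʳ (trans (T-suc-*-suc 1 1) (+-comm _ _)) ⟩
      p * q * T 1 * T 1 + T 3 - T 3     ≈⟨ //-rightDividesʳ (T 3) _ ⟩
      p * q * T 1 * T 1                 ≈⟨ *-cong (*-congˡ T-1) T-1 ⟩
      p * q * 1# * 1#                   ≈⟨ trans (*-identityʳ _) (*-identityʳ _) ⟩
      p * q                             ∎

  Tnom-integral : ∀ m k → Integral (Tnom m k)
  Tnom-integral zero    k       = 1#-integral
  Tnom-integral (suc m) zero    = 1#-integral
  Tnom-integral (suc m) (suc k) =
    Integral-- (Integral-* (T-integral (suc (suc m))) (Tnom-integral (suc m) k))
               (Integral-* (Integral-* pq-integral (T-integral k)) (Tnom-integral m (suc k)))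

  ι-Tfact : ∀ j → ι (Tfact N j) ≈ T! j
  ι-Tfact zero    = +-identityʳ 1#
  ι-Tfact (suc j) = trans (ι-homo-* (N (suc j)) (Tfact N j)) (*-cong (ι-N≈T (suc j) (ℕ.s≤s ℕ.z≤n)) (ι-Tfact j))

  ι-Tfact-* : ∀ k m → ι (Tfact N k ℕ.* Tfact N m) ≈ T! k * T! m
  ι-Tfact-* k m = trans (ι-homo-* (Tfact N k) (Tfact N m)) (*-cong (ι-Tfact k) (ι-Tfact m))

  Tfact-*-nonZero : ∀ k m → NonZero (Tfact N k ℕ.* Tfact N m)
  Tfact-*-nonZero k m = ℕ.m*n≢0 _ _ {{Tfact-nonZero N N-positive k}} {{Tfact-nonZero N N-positive m}}

  module _ (noZeroDiv : NoZeroDivisors) (char0 : HasCharZero) where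

    hsum≈Tnom : ∀ m k → hsum p q (suc m) k ≈ Tnom m k
    hsum≈Tnom m k = *-almostCancelˡ noZeroDiv (T! k * T! m) _ _ T!k*T!m≉0 (trans (T!-hsum m k) (sym (T!-Tnom m k)))
      where
      T!k*T!m≉0 : ¬ T! k * T! m ≈ 0#
      T!k*T!m≉0 = ι-nonZero char0 _ {{Tfact-*-nonZero k m}} ∘ trans (ι-Tfact-* k m)

    ι-Tbinom≈hsum : ∀ m k → ι (Tbinom N (m ℕ.+ k) k) ≈ hsum p q (suc m) k
    ι-Tbinom≈hsum m k = begin
      ι (Tbinom N (m ℕ.+ k) k)            ≡⟨ cong ι (Tbinom-≤ N (ℕ.m≤n+m k m)) ⟩
      ι (div Fm+k (Tfact N k ℕ.* Tfact N (m ℕ.+ k ∸ k)))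
                                          ≡⟨ cong (λ j → ι (div Fm+k (Tfact N k ℕ.* Tfact N j))) (ℕ.m+n∸n≡m m k) ⟩
      ι (div Fm+k (Tfact N k ℕ.* Tfact N m))
                                          ≈⟨ ι-div noZeroDiv char0 Fm+k _ {{Tfact-*-nonZero k m}}
                                               (Integral-resp-≈ (sym (hsum≈Tnom m k)) (Tnom-integral m k))
                                               (trans (*-congʳ (ι-Tfact-* k m)) (trans (T!-hsum m k) (sym (ι-Tfact (m ℕ.+ k))))) ⟩
      hsum p q (suc m) k                  ∎
      where
      Fm+k : ℕ
      Fm+k = Tfact N (m ℕ.+ k)

open import Data.Nat using (_+_)
open CommutativeRing using (Carrier; _≈_; _*_; 0#)

corollary1 : ∀ {c ℓ : Level} (R : CommutativeRing c ℓ) →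
    (∀ x y → _≈_ R (_*_ R x y) (0# R) → _≈_ R x (0# R) ⊎ _≈_ R y (0# R)) →
    (∀ m → ¬ (_≈_ R (Over.ι R (suc m)) (0# R))) →
    (p q : Carrier R) (N : ℕ → ℕ) →
    (∀ n → 1 ≤ n → 0 < N n) →
    (∀ n → 1 ≤ n → _≈_ R (Over.ι R (N n)) (Over.Tseq R p q n)) →
    (n k : ℕ) → 1 ≤ n →
    _≈_ R (Over.ι R (Tbinom N (n + k ∸ 1) k)) (Over.hsum R p q n k)
corollary1 R noZeroDiv char0 p q N N-positive ι-N≈T (suc m) k _ =
  TIntegrality.ι-Tbinom≈hsum R p q N N-positive ι-N≈T noZeroDiv char0 m k
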